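{- Let $A\in\mathbb{Z}^{d\times n}$ have rank $d$, with $n>d$. Then the Fast Generalized Euclidean Algorithm described in the context, run on $A$ (with any admissible choices of the pivot indices $\ell$), returns a matrix $S\in\mathbb{Z}^{d\times d}$ with $\mathcal{L}(A)=\mathcal{L}(S)$.
   Context: For a matrix $M$ with columns $M_1,\dots,M_k\in\mathbb{Z}^d$, $\mathcal{L}(M)=\{\sum_i\lambda_iM_i:\lambda\in\mathbb{Z}^k\}$. $e_\ell$ denotes the $\ell$-th unit vector. Fast Generalized Euclidean Algorithm, input $A\in\mathbb{Z}^{d\times n}$, with $m:=n-d$: 1. Choose $d$ linearly independent columns of $A$, forming $B=(B_1,\dots,B_d)\in\mathbb{Z}^{d\times d}$; let $C=(C_1,\dots,C_m)$ be the matrix of the remaining columns. 2. Compute the rational matrix $X\in\mathbb{Q}^{d\times m}$ with $BX=C$; denote its $j$-th column by $x^{(j)}$. 3. For $i=1,\dots,d$: choose an index $\ell\in\{1,\dots,d\}$ not chosen in an earlier iteration. Let $t$ be a positive integer such that $t\,x^{(j)}_\ell\in\mathbb{Z}$ for all $j$ (the translate of $B_\ell$), and put $t_j:=t\,x^{(j)}_\ell$ (the translate of $C_j$ with respect to the subspace spanned by the columns of $B$ other than $B_\ell$). Set $g_0:=t$ and $Z_0:=e_\ell$. For $j=1,\dots,m$: let $g_j:=\gcd(g_{j-1},t_j)$ $(=\gcd(t,t_1,\dots,t_j))$, choose integers $\alpha_j,\beta_j$ with $g_j=\alpha_jg_{j-1}+\beta_jt_j$, set $Z_j:=\alpha_jZ_{j-1}+\beta_jx^{(j)}$,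 and then replace $x^{(j)}$ by $(g_{j-1}/g_j)\,x^{(j)}-(t_j/g_j)\,Z_{j-1}$. Finally set $Y_i:=Z_m$. 4. Return $S:=BY$, where $Y$ is the matrix with columns $Y_1,\dots,Y_d$. -}

module Defs where

open import Data.Nat as ℕ using (ℕ; zero; suc; _∸_)
open import Data.Integer as ℤ using (ℤ; +_)
open import Data.Integer.GCD using (gcd)
open import Data.Rational as ℚ using (ℚ; 0ℚ; 1ℚ)
open import Data.Fin using (Fin; zero; suc; _≟_)
open import Data.Vec using (Vec; []; _∷_; lookup)
open import Data.Sum using (_⊎_; inj₁; inj₂)
open import Data.Product using (∃; Σ; _×_; _,_)
open import Relation.Binary.PropositionalEquality using (_≡_)
open import Relation.Nullary using (yes; no)

⟦_⟧ : ℤ → ℚ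
⟦ z ⟧ = z ℚ./ 1

Σℚ : ∀ {k} → (Fin k → ℚ) → ℚ
Σℚ {zero}  f = 0ℚ
Σℚ {suc k} f = f zero ℚ.+ Σℚ (λ i → f (suc i))

-- Vectors of ℚ^d (columns) and d×k matrices M r c (row r, column c).
Col : ℕ → Set
Col d = Fin d → ℚ

Mat : ℕ → ℕ → Set
Mat d k = Fin d → Fin k → ℚ

toℚMat : ∀ {d k} → (Fin d → Fin k → ℤ) → Mat d k
toℚMat A r c = ⟦ A r c ⟧

unit : ∀ {d} → Fin d → Col d
unit ℓ r with r ≟ ℓ
... | yes _ = 1ℚ
... | no  _ = 0ℚ

_·_ : ∀ {d} → ℤ → Col d → Col d
(a · v) r = ⟦ a ⟧ ℚ.* v r

_⊕_ : ∀ {d} → Col d → Col d → Col d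
(v ⊕ w) r = v r ℚ.+ w r

_⊖_ : ∀ {d} → Col d → Col d → Col d
(v ⊖ w) r = v r ℚ.- w r

infixl 7 _·_
infixl 6 _⊕_ _⊖_

_⊛_ : ∀ {d k} → Mat d k → (Fin k → ℚ) → Col d
(M ⊛ v) r = Σℚ (λ c → M r c ℚ.* v c)

InLattice : ∀ {d k} → Mat d k → Col d → Set
InLattice {d} {k} M v = Σ (Fin k → ℤ) (λ coeff → ∀ r → v r ≡ (M ⊛ (λ c → ⟦ coeff c ⟧)) r)

RowsIndependent : ∀ {d n} → Mat d n → Set
RowsIndependent {d} {n} M =
  (c : Fin d → ℚ) → (∀ k → Σℚ (λ r → c r ℚ.* M r k) ≡ 0ℚ) → ∀ r → c r ≡ 0ℚ

ColsIndependent : ∀ {d k} → Mat d k → Set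
ColsIndependent {d} {k} M =
  (c : Fin k → ℚ) → (∀ r → (M ⊛ c) r ≡ 0ℚ) → ∀ i → c i ≡ 0ℚ

-- Inner loop (j = 1..m) of one iteration of step 3, for pivot ℓ and translate t.
-- InnerRun ℓ t g Z xs xs' Zf : starting from g_{j-1} = g and Z_{j-1} = Z, processing
-- the (current) columns xs = x^(j),...,x^(m) in order, with admissible choices of the
-- Bézout coefficients α_j, β_j, yields the replaced columns xs' and final Z_m = Zf.
-- The translate t_j is the integer with t·x^(j)_ℓ = t_j; g_j = gcd(g_{j-1}, t_j);
-- u, v are the exact integer quotients g_{j-1}/g_j and t_j/g_j.
data InnerRun {d : ℕ} (ℓ : Fin d) (t : ℤ) : ℤ → Col d → ∀ {k} → Vec (Col d) k → Vec (Col d) k → Col d → Set where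
  done : ∀ {g Z} → InnerRun ℓ t g Z [] [] Z
  step : ∀ {g Z k} {x : Col d} {xs xs' : Vec (Col d) k} {Zf : Col d}
       → (tj α β u v : ℤ)
       → ⟦ t ⟧ ℚ.* x ℓ ≡ ⟦ tj ⟧
       → gcd g tj ≡ α ℤ.* g ℤ.+ β ℤ.* tj
       → g ≡ u ℤ.* gcd g tj
       → tj ≡ v ℤ.* gcd g tj
       → InnerRun ℓ t (gcd g tj) (α · Z ⊕ β · x) xs xs' Zf
       → InnerRun ℓ t g Z (x ∷ xs) ((u · x ⊖ v · Z) ∷ xs') Zf

-- Outer loop (i = 1..k) of step 3.  OuterRun X ℓs Ys : starting from current columns X,
-- performing iterations with pivots ℓs (in order) and positive translates t, yields
-- Y_i (in order).  Distinctness of the pivots is imposed separately.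
data OuterRun {d m : ℕ} : Vec (Col d) m → ∀ {k} → Vec (Fin d) k → Vec (Col d) k → Set where
  done : ∀ {X} → OuterRun X [] []
  step : ∀ {X X' : Vec (Col d) m} {k} {ℓs : Vec (Fin d) k} {Ys : Vec (Col d) k} {Y : Col d}
       → (ℓ : Fin d) (t : ℕ) → 0 ℕ.< t
       → InnerRun ℓ (+ t) (+ t) (unit ℓ) X X' Y
       → OuterRun X' ℓs Ys
       → OuterRun X (ℓ ∷ ℓs) (Y ∷ Ys)

Distinct : ∀ {a k} → Vec (Fin a) k → Set
Distinct {a} {k} v = ∀ i j → lookup v i ≡ lookup v j → i ≡ j

-- Each step of the inner loop replaces the pair of generators (Z, x) by (αZ + βx, ux − vZ) with
-- u = g_{j-1}/g_j and v = t_j/g_j.  Since g_j = α g_{j-1} + β t_j, this change of basis has determinant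
-- αu + βv = 1, so it preserves the ℤ-span of e_ℓ and the current columns; over a whole run the ℤ-span of
-- the unit vectors and the columns of X is therefore unchanged, merely re-presented by Y and the final
-- columns.  The Bézout relations also maintain t Z_ℓ = g_j, so t times the ℓ-th coordinate of a replaced
-- column is u t_j − v g_{j-1} = uv g_j − vu g_j = 0.  Later iterations only mix these columns with unit
-- vectors of fresh pivots, so once all d distinct pivots are used the final columns vanish.  Multiplying
-- by B sends the unit vectors and X onto the columns of A (as BX = C), and Y onto the columns of S; hence
-- 𝓛(A) = 𝓛(S), and S is integral because its columns lie in 𝓛(A).

module Submission where

open import Defs
open import Level using (0ℓ)
open import Data.Nat as ℕ using (ℕ; _<_; _∸_; suc)
import Data.Nat.Properties as ℕP
open import Data.Integer as ℤ using (ℤ; +_)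
import Data.Integer.Properties as ℤP
open import Data.Integer.GCD using (gcd)
import Data.Integer.Tactic.RingSolver as ℤSolver
open import Data.Rational as ℚ using (ℚ; 0ℚ; 1ℚ; mkℚ; toℚᵘ)
import Data.Rational.Properties as ℚP
import Data.Rational.Unnormalised as ℚᵘ
import Data.Rational.Unnormalised.Properties as ℚᵘP
open import Data.Rational.Solver using (module +-*-Solver)
open import Data.Nat.Coprimality using (1-coprimeTo) renaming (sym to coprime-sym)
open import Data.Fin as Fin using (Fin; zero; suc; _≟_)
import Data.Fin.Properties as FinP
open import Data.List as List using (List; []; _∷_; _++_; map; tabulate)
open import Data.List.Membership.Propositional using (_∈_)
open import Data.List.Membership.Propositional.Properties
  using (∈-++⁺ˡ; ∈-++⁺ʳ; ∈-++⁻; ∈-map⁺; ∈-map⁻; ∈-tabulate⁺; ∈-tabulate⁻)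
open import Data.List.Relation.Unary.Any using (here; there)
open import Data.List.Relation.Binary.Permutation.Propositional using (_↭_; prep; swap; ↭-refl; ↭-sym)
open import Data.List.Relation.Binary.Permutation.Propositional.Properties using (∈-resp-↭; ++-comm)
open import Data.Vec using (Vec; []; _∷_; lookup; toList)
import Data.Vec.Membership.Propositional.Properties as VecMem
import Data.Vec.Relation.Unary.Any as VecAny
import Data.Vec.Relation.Unary.Any.Properties as VecAnyP
open import Data.Sum using (_⊎_; inj₁; inj₂; [_,_])
open import Data.Product using (Σ; _×_; _,_; proj₁; proj₂; ∃)
open import Data.Empty using (⊥)
open import Function using (_∘_)
open import Function.Bundles using (_⇔_; mk⇔)
open import Function.Properties.Equivalence using () renaming (trans to ⇔-trans; sym to ⇔-sym)
open import Relation.Nullary using (¬_; yes; no; contradiction)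
open import Relation.Unary using (Pred; _⊆_; _∪_; ｛_｝)
open import Relation.Binary.Bundles using (Setoid)
import Relation.Binary.Reasoning.Setoid
open import Relation.Binary.PropositionalEquality
  using (_≡_; _≢_; _≗_; refl; sym; trans; cong; cong₂; subst; module ≡-Reasoning)

open +-*-Solver using (solve; _:=_; _:+_; _:*_; _:-_; :-_; con)

-- The embedding ℤ → ℚ

-- ⟦ z ⟧ = z / 1 is by definition ↥ p / ↧ p for the normal form p of z, so ↥p/↧p≡p identifies the two.
private
  ⟦⟧-as-mkℚ : ∀ z → ⟦ z ⟧ ≡ mkℚ z 0 (coprime-sym (1-coprimeTo ℤ.∣ z ∣))
  ⟦⟧-as-mkℚ z = ℚP.↥p/↧p≡p (mkℚ z 0 (coprime-sym (1-coprimeTo ℤ.∣ z ∣)))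

  toℚᵘ-⟦⟧ : ∀ z → toℚᵘ ⟦ z ⟧ ≡ ℚᵘ.mkℚᵘ z 0
  toℚᵘ-⟦⟧ z = cong toℚᵘ (⟦⟧-as-mkℚ z)

⟦⟧-+ : ∀ a b → ⟦ a ℤ.+ b ⟧ ≡ ⟦ a ⟧ ℚ.+ ⟦ b ⟧
⟦⟧-+ a b = ℚP.toℚᵘ-injective (begin
  toℚᵘ ⟦ a ℤ.+ b ⟧                 ≡⟨ toℚᵘ-⟦⟧ (a ℤ.+ b) ⟩
  ℚᵘ.mkℚᵘ (a ℤ.+ b) 0              ≈⟨ ℚᵘ.*≡* cross ⟩
  ℚᵘ.mkℚᵘ a 0 ℚᵘ.+ ℚᵘ.mkℚᵘ b 0     ≡⟨ cong₂ ℚᵘ._+_ (toℚᵘ-⟦⟧ a) (toℚᵘ-⟦⟧ b) ⟨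
  toℚᵘ ⟦ a ⟧ ℚᵘ.+ toℚᵘ ⟦ b ⟧       ≈⟨ ℚP.toℚᵘ-homo-+ ⟦ a ⟧ ⟦ b ⟧ ⟨
  toℚᵘ (⟦ a ⟧ ℚ.+ ⟦ b ⟧)           ∎)
  where
  open ℚᵘP.≃-Reasoning
  cross : (a ℤ.+ b) ℤ.* + 1 ≡ (a ℤ.* + 1 ℤ.+ b ℤ.* + 1) ℤ.* + 1
  cross = ℤSolver.solve (a List.∷ b List.∷ List.[])

⟦⟧-* : ∀ a b → ⟦ a ℤ.* b ⟧ ≡ ⟦ a ⟧ ℚ.* ⟦ b ⟧
⟦⟧-* a b = ℚP.toℚᵘ-injective (begin
  toℚᵘ ⟦ a ℤ.* b ⟧                 ≡⟨ toℚᵘ-⟦⟧ (a ℤ.* b) ⟩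
  ℚᵘ.mkℚᵘ (a ℤ.* b) 0              ≡⟨ cong₂ ℚᵘ._*_ (toℚᵘ-⟦⟧ a) (toℚᵘ-⟦⟧ b) ⟨
  toℚᵘ ⟦ a ⟧ ℚᵘ.* toℚᵘ ⟦ b ⟧       ≈⟨ ℚP.toℚᵘ-homo-* ⟦ a ⟧ ⟦ b ⟧ ⟨
  toℚᵘ (⟦ a ⟧ ℚ.* ⟦ b ⟧)           ∎)
  where open ℚᵘP.≃-Reasoning

⟦⟧-neg : ∀ a → ⟦ ℤ.- a ⟧ ≡ ℚ.- ⟦ a ⟧
⟦⟧-neg a = begin
  ⟦ ℤ.- a ⟧                ≡⟨ cong ⟦_⟧ (ℤP.-1*i≡-i a) ⟨
  ⟦ ℤ.-1ℤ ℤ.* a ⟧     ≡⟨ ⟦⟧-* ℤ.-1ℤ a ⟩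
  ℚ.- 1ℚ ℚ.* ⟦ a ⟧         ≡⟨ solve 1 (λ x → con (ℚ.- 1ℚ) :* x := :- x) refl ⟦ a ⟧ ⟩
  ℚ.- ⟦ a ⟧                ∎
  where open ≡-Reasoning

⟦⟧≡0⇒≡0 : ∀ a → ⟦ a ⟧ ≡ 0ℚ → a ≡ + 0
⟦⟧≡0⇒≡0 a eq = trans (sym (cong ℚ.↥_ (⟦⟧-as-mkℚ a))) (ℚP.p≡0⇒↥p≡0 ⟦ a ⟧ eq)

⟦⟧-*-cancelˡ : ∀ a {q} → a ≢ + 0 → ⟦ a ⟧ ℚ.* q ≡ 0ℚ → q ≡ 0ℚ
⟦⟧-*-cancelˡ a {q} a≢0 eq = begin
  q                          ≡⟨ ℚP.*-identityˡ q ⟨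
  1ℚ ℚ.* q                   ≡⟨ cong (ℚ._* q) (ℚP.*-inverseˡ p) ⟨
  (ℚ.1/ p ℚ.* p) ℚ.* q       ≡⟨ ℚP.*-assoc (ℚ.1/ p) p q ⟩
  ℚ.1/ p ℚ.* (p ℚ.* q)       ≡⟨ cong (ℚ.1/ p ℚ.*_) eq ⟩
  ℚ.1/ p ℚ.* 0ℚ              ≡⟨ ℚP.*-zeroʳ (ℚ.1/ p) ⟩
  0ℚ                         ∎
  where
  open ≡-Reasoning
  p = ⟦ a ⟧
  instance
    p≢0 : ℚ.NonZero p
    p≢0 = ℚ.≢-nonZero (a≢0 ∘ ⟦⟧≡0⇒≡0 a)

-- Finite sums and matrix–vector products

Σℚ-cong : ∀ {k} {f g : Fin k → ℚ} → f ≗ g → Σℚ f ≡ Σℚ g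
Σℚ-cong {ℕ.zero} f≗g = refl
Σℚ-cong {suc k}  f≗g = cong₂ ℚ._+_ (f≗g zero) (Σℚ-cong (f≗g ∘ suc))

Σℚ-zero : ∀ {k} {f : Fin k → ℚ} → (∀ i → f i ≡ 0ℚ) → Σℚ f ≡ 0ℚ
Σℚ-zero {ℕ.zero} f≡0 = refl
Σℚ-zero {suc k}  f≡0 = cong₂ ℚ._+_ (f≡0 zero) (Σℚ-zero (f≡0 ∘ suc))

Σℚ-single : ∀ {k} {f : Fin k → ℚ} i → (∀ j → j ≢ i → f j ≡ 0ℚ) → Σℚ f ≡ f i
Σℚ-single {suc k} {f} zero    f≡0 = begin
  f zero ℚ.+ Σℚ (f ∘ suc)    ≡⟨ cong (f zero ℚ.+_) (Σℚ-zero (λ j → f≡0 (suc j) λ ())) ⟩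
  f zero ℚ.+ 0ℚ              ≡⟨ ℚP.+-identityʳ (f zero) ⟩
  f zero                     ∎
  where open ≡-Reasoning
Σℚ-single {suc k} {f} (suc i) f≡0 = begin
  f zero ℚ.+ Σℚ (f ∘ suc)    ≡⟨ cong₂ ℚ._+_ (f≡0 zero λ ()) (Σℚ-single i (λ j j≢i → f≡0 (suc j) (j≢i ∘ FinP.suc-injective))) ⟩
  0ℚ ℚ.+ f (suc i)           ≡⟨ ℚP.+-identityˡ (f (suc i)) ⟩
  f (suc i)                  ∎
  where open ≡-Reasoning

Σℚ-comb : ∀ {k} a b (f g : Fin k → ℚ) →
          Σℚ (λ i → a ℚ.* f i ℚ.+ b ℚ.* g i) ≡ a ℚ.* Σℚ f ℚ.+ b ℚ.* Σℚ g
Σℚ-comb {ℕ.zero} a b f g = solve 2 (λ a b → con 0ℚ := a :* con 0ℚ :+ b :* con 0ℚ) refl a b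
Σℚ-comb {suc k}  a b f g = begin
  (a ℚ.* f zero ℚ.+ b ℚ.* g zero) ℚ.+ Σℚ (λ i → a ℚ.* f (suc i) ℚ.+ b ℚ.* g (suc i))
    ≡⟨ cong (a ℚ.* f zero ℚ.+ b ℚ.* g zero ℚ.+_) (Σℚ-comb a b (f ∘ suc) (g ∘ suc)) ⟩
  (a ℚ.* f zero ℚ.+ b ℚ.* g zero) ℚ.+ (a ℚ.* Σℚ (f ∘ suc) ℚ.+ b ℚ.* Σℚ (g ∘ suc))
    ≡⟨ solve 6 (λ a b x y X Y → (a :* x :+ b :* y) :+ (a :* X :+ b :* Y)
                               := a :* (x :+ X) :+ b :* (y :+ Y))
             refl a b (f zero) (g zero) (Σℚ (f ∘ suc)) (Σℚ (g ∘ suc)) ⟩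
  a ℚ.* (f zero ℚ.+ Σℚ (f ∘ suc)) ℚ.+ b ℚ.* (g zero ℚ.+ Σℚ (g ∘ suc))
    ∎
  where open ≡-Reasoning

𝟘 : ∀ {d} → Col d
𝟘 _ = 0ℚ

column : ∀ {d k} → Mat d k → Fin k → Col d
column M c r = M r c

⊛-cong : ∀ {d k} (M : Mat d k) {v w : Col k} → v ≗ w → M ⊛ v ≗ M ⊛ w
⊛-cong M v≗w r = Σℚ-cong (λ c → cong (M r c ℚ.*_) (v≗w c))

⊛-𝟘 : ∀ {d k} (M : Mat d k) → M ⊛ 𝟘 ≗ 𝟘
⊛-𝟘 M r = Σℚ-zero (λ c → ℚP.*-zeroʳ (M r c))

⊛-comb : ∀ {d k} (M : Mat d k) a b (v w : Col k) →
         M ⊛ (a · v ⊕ b · w) ≗ a · (M ⊛ v) ⊕ b · (M ⊛ w)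
⊛-comb M a b v w r = trans (Σℚ-cong distrib) (Σℚ-comb ⟦ a ⟧ ⟦ b ⟧ (λ c → M r c ℚ.* v c) (λ c → M r c ℚ.* w c))
  where
  distrib : ∀ c → M r c ℚ.* (⟦ a ⟧ ℚ.* v c ℚ.+ ⟦ b ⟧ ℚ.* w c)
                ≡ ⟦ a ⟧ ℚ.* (M r c ℚ.* v c) ℚ.+ ⟦ b ⟧ ℚ.* (M r c ℚ.* w c)
  distrib c = solve 5 (λ m a x b y → m :* (a :* x :+ b :* y) := a :* (m :* x) :+ b :* (m :* y))
                    refl (M r c) ⟦ a ⟧ (v c) ⟦ b ⟧ (w c)

unit-diag : ∀ {d} (i : Fin d) → unit i i ≡ 1ℚ
unit-diag i with i ≟ i
... | yes _   = refl
... | no  i≢i = contradiction refl i≢i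

unit-offdiag : ∀ {d} {i j : Fin d} → j ≢ i → unit i j ≡ 0ℚ
unit-offdiag {i = i} {j} j≢i with j ≟ i
... | yes j≡i = contradiction j≡i j≢i
... | no  _   = refl

⊛-unit : ∀ {d k} (M : Mat d k) c → M ⊛ unit c ≗ column M c
⊛-unit M c r = begin
  Σℚ (λ c′ → M r c′ ℚ.* unit c c′)   ≡⟨ Σℚ-single c (λ c′ c′≢c → trans (cong (M r c′ ℚ.*_) (unit-offdiag c′≢c)) (ℚP.*-zeroʳ (M r c′))) ⟩
  M r c ℚ.* unit c c                 ≡⟨ cong (M r c ℚ.*_) (unit-diag c) ⟩
  M r c ℚ.* 1ℚ                       ≡⟨ ℚP.*-identityʳ (M r c) ⟩
  M r c                              ∎
  where open ≡-Reasoning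

⟦⟧-comb : ∀ a x b y → ⟦ a ℤ.* x ℤ.+ b ℤ.* y ⟧ ≡ ⟦ a ⟧ ℚ.* ⟦ x ⟧ ℚ.+ ⟦ b ⟧ ℚ.* ⟦ y ⟧
⟦⟧-comb a x b y = trans (⟦⟧-+ (a ℤ.* x) (b ℤ.* y)) (cong₂ ℚ._+_ (⟦⟧-* a x) (⟦⟧-* b y))

-- ℤ-spans of finite families of vectors

record IsSubmodule {d} (P : Pred (Col d) 0ℓ) : Set where
  field
    resp : ∀ {v w} → v ≗ w → P w → P v
    𝟘∈   : P 𝟘
    comb : ∀ a b {v w} → P v → P w → P (a · v ⊕ b · w)

data Span {d} (gs : List (Col d)) : Pred (Col d) 0ℓ where
  gen  : ∀ {v} → v ∈ gs → Span gs v
  𝟘∈   : Span gs 𝟘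
  comb : ∀ a b {v w} → Span gs v → Span gs w → Span gs (a · v ⊕ b · w)
  resp : ∀ {v w} → v ≗ w → Span gs w → Span gs v

Span-isSubmodule : ∀ {d} {gs : List (Col d)} → IsSubmodule (Span gs)
Span-isSubmodule = record { resp = resp ; 𝟘∈ = 𝟘∈ ; comb = comb }

Span-minimal : ∀ {d} {gs : List (Col d)} {P : Pred (Col d) 0ℓ} →
               IsSubmodule P → (_∈ gs) ⊆ P → Span gs ⊆ P
Span-minimal P-sub gs⊆P (gen g∈)           = gs⊆P g∈
Span-minimal P-sub gs⊆P 𝟘∈                 = IsSubmodule.𝟘∈ P-sub
Span-minimal P-sub gs⊆P (comb a b sv sw)   =
  IsSubmodule.comb P-sub a b (Span-minimal P-sub gs⊆P sv) (Span-minimal P-sub gs⊆P sw)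
Span-minimal P-sub gs⊆P (resp v≗w sw)      = IsSubmodule.resp P-sub v≗w (Span-minimal P-sub gs⊆P sw)

infix 4 _⊑_ _∼_

_⊑_ : ∀ {d} → List (Col d) → List (Col d) → Set
gs ⊑ hs = (_∈ gs) ⊆ Span hs

_∼_ : ∀ {d} → List (Col d) → List (Col d) → Set
gs ∼ hs = gs ⊑ hs × hs ⊑ gs

Span-mono : ∀ {d} {gs hs : List (Col d)} → gs ⊑ hs → Span gs ⊆ Span hs
Span-mono = Span-minimal Span-isSubmodule

∼-refl : ∀ {d} {gs : List (Col d)} → gs ∼ gs
∼-refl = gen , gen

∼-sym : ∀ {d} {gs hs : List (Col d)} → gs ∼ hs → hs ∼ gs
∼-sym (gs⊑hs , hs⊑gs) = hs⊑gs , gs⊑hs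

∼-trans : ∀ {d} {gs hs ks : List (Col d)} → gs ∼ hs → hs ∼ ks → gs ∼ ks
∼-trans (gs⊑hs , hs⊑gs) (hs⊑ks , ks⊑hs) = Span-mono hs⊑ks ∘ gs⊑hs , Span-mono hs⊑gs ∘ ks⊑hs

∼-setoid : ℕ → Setoid 0ℓ 0ℓ
∼-setoid d = record
  { Carrier       = List (Col d)
  ; _≈_           = _∼_
  ; isEquivalence = record { refl = ∼-refl ; sym = ∼-sym ; trans = ∼-trans }
  }

module ∼-Reasoning {d} = Relation.Binary.Reasoning.Setoid (∼-setoid d)

∼⇒Span⇔ : ∀ {d} {gs hs : List (Col d)} → gs ∼ hs → ∀ v → Span gs v ⇔ Span hs v
∼⇒Span⇔ (gs⊑hs , hs⊑gs) v = mk⇔ (Span-mono gs⊑hs) (Span-mono hs⊑gs)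

∼-reflexive : ∀ {d} {gs hs : List (Col d)} → gs ≡ hs → gs ∼ hs
∼-reflexive refl = ∼-refl

↭⇒∼ : ∀ {d} {gs hs : List (Col d)} → gs ↭ hs → gs ∼ hs
↭⇒∼ gs↭hs = gen ∘ ∈-resp-↭ gs↭hs , gen ∘ ∈-resp-↭ (↭-sym gs↭hs)

∼-++ : ∀ {d} {gs gs′ hs hs′ : List (Col d)} → gs ∼ gs′ → hs ∼ hs′ → gs ++ hs ∼ gs′ ++ hs′
∼-++ (gs⊑ , ⊒gs) (hs⊑ , ⊒hs) = ⊑-++ gs⊑ hs⊑ , ⊑-++ ⊒gs ⊒hs
  where
  ⊑-++ : ∀ {as as′ bs bs′ : List (Col _)} → as ⊑ as′ → bs ⊑ bs′ → as ++ bs ⊑ as′ ++ bs′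
  ⊑-++ {as} {as′} as⊑ bs⊑ x∈ =
    [ Span-mono (gen ∘ ∈-++⁺ˡ) ∘ as⊑ , Span-mono (gen ∘ ∈-++⁺ʳ as′) ∘ bs⊑ ] (∈-++⁻ as x∈)

∼-∷ : ∀ {d} (v : Col d) {gs hs : List (Col d)} → gs ∼ hs → v ∷ gs ∼ v ∷ hs
∼-∷ v = ∼-++ {gs = v ∷ []} ∼-refl

++-null : ∀ {d} (gs : List (Col d)) {zs : List (Col d)} → (_∈ zs) ⊆ (_≗ 𝟘) → gs ++ zs ∼ gs
++-null gs zs≗𝟘 =
  (λ x∈ → [ gen , (λ z∈ → resp (zs≗𝟘 z∈) 𝟘∈) ] (∈-++⁻ gs x∈)) , gen ∘ ∈-++⁺ˡ

Span-map : ∀ {d k} (M : Mat d k) {gs : List (Col k)} {v} → Span gs v → Span (map (M ⊛_) gs) (M ⊛ v)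
Span-map M {gs} = Span-minimal {P = λ v → Span (map (M ⊛_) gs) (M ⊛ v)} image-isSubmodule (gen ∘ ∈-map⁺ (M ⊛_))
  where
  image-isSubmodule : IsSubmodule (λ v → Span (map (M ⊛_) gs) (M ⊛ v))
  image-isSubmodule = record
    { resp = λ v≗w → resp (⊛-cong M v≗w)
    ; 𝟘∈   = resp (⊛-𝟘 M) 𝟘∈
    ; comb = λ a b {v} {w} sv sw → resp (⊛-comb M a b v w) (comb a b sv sw)
    }

∼-map : ∀ {d k} (M : Mat d k) {gs hs : List (Col k)} → gs ∼ hs → map (M ⊛_) gs ∼ map (M ⊛_) hs
∼-map M (gs⊑hs , hs⊑gs) = ⊑-map gs⊑hs , ⊑-map hs⊑gs
  where
  ⊑-map : ∀ {as bs} → as ⊑ bs → map (M ⊛_) as ⊑ map (M ⊛_) bs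
  ⊑-map as⊑bs x∈ with ∈-map⁻ (M ⊛_) x∈
  ... | _ , w∈ , refl = Span-map M (as⊑bs w∈)

-- Integrality, vanishing coordinates and 𝓛(M)

IsIntegral : ∀ {d} → Pred (Col d) 0ℓ
IsIntegral v = ∀ r → Σ ℤ λ z → v r ≡ ⟦ z ⟧

integral-isSubmodule : ∀ {d} → IsSubmodule (IsIntegral {d})
integral-isSubmodule = record
  { resp = λ v≗w w-int r → proj₁ (w-int r) , trans (v≗w r) (proj₂ (w-int r))
  ; 𝟘∈   = λ r → + 0 , refl
  ; comb = λ a b v-int w-int r →
      let (x , v≡x) = v-int r ; (y , w≡y) = w-int r
      in a ℤ.* x ℤ.+ b ℤ.* y
       , trans (cong₂ (λ p q → ⟦ a ⟧ ℚ.* p ℚ.+ ⟦ b ⟧ ℚ.* q) v≡x w≡y) (sym (⟦⟧-comb a x b y))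
  }

Vanishes : ∀ {d} → Pred (Fin d) 0ℓ → Pred (Col d) 0ℓ
Vanishes Q v = ∀ r → Q r → v r ≡ 0ℚ

vanishes-isSubmodule : ∀ {d} (Q : Pred (Fin d) 0ℓ) → IsSubmodule (Vanishes Q)
vanishes-isSubmodule Q = record
  { resp = λ v≗w w-van r q → trans (v≗w r) (w-van r q)
  ; 𝟘∈   = λ r q → refl
  ; comb = λ a b v-van w-van r q →
      trans (cong₂ (λ p q → ⟦ a ⟧ ℚ.* p ℚ.+ ⟦ b ⟧ ℚ.* q) (v-van r q) (w-van r q))
              (solve 2 (λ a b → a :* con 0ℚ :+ b :* con 0ℚ := con 0ℚ) refl ⟦ a ⟧ ⟦ b ⟧)
  }

Vanishes-anti : ∀ {d} {Q R : Pred (Fin d) 0ℓ} → R ⊆ Q → Vanishes Q ⊆ Vanishes R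
Vanishes-anti R⊆Q v-van r = v-van r ∘ R⊆Q

columns : ∀ {d k} → Mat d k → List (Col d)
columns M = tabulate (column M)

δ : ∀ {k} → Fin k → Fin k → ℤ
δ c c′ with c′ ≟ c
... | yes _ = + 1
... | no  _ = + 0

⟦δ⟧≡unit : ∀ {k} (c c′ : Fin k) → ⟦ δ c c′ ⟧ ≡ unit c c′
⟦δ⟧≡unit c c′ with c′ ≟ c
... | yes _ = refl
... | no  _ = refl

inLattice-isSubmodule : ∀ {d k} (M : Mat d k) → IsSubmodule (InLattice M)
inLattice-isSubmodule M = record
  { resp = λ v≗w (λw , w≗) → λw , λ r → trans (v≗w r) (w≗ r)
  ; 𝟘∈   = (λ _ → + 0) , λ r → sym (⊛-𝟘 M r)
  ; comb = comb-closed
  }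
  where
  comb-closed : ∀ a b {v w} → InLattice M v → InLattice M w → InLattice M (a · v ⊕ b · w)
  comb-closed a b {v} {w} (λv , v≗) (λw , w≗) = (λ c → a ℤ.* λv c ℤ.+ b ℤ.* λw c) , λ r → begin
    ⟦ a ⟧ ℚ.* v r ℚ.+ ⟦ b ⟧ ℚ.* w r
      ≡⟨ cong₂ (λ p q → ⟦ a ⟧ ℚ.* p ℚ.+ ⟦ b ⟧ ℚ.* q) (v≗ r) (w≗ r) ⟩
    (a · (M ⊛ (⟦_⟧ ∘ λv)) ⊕ b · (M ⊛ (⟦_⟧ ∘ λw))) r
      ≡⟨ ⊛-comb M a b (⟦_⟧ ∘ λv) (⟦_⟧ ∘ λw) r ⟨
    (M ⊛ (a · (⟦_⟧ ∘ λv) ⊕ b · (⟦_⟧ ∘ λw))) r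
      ≡⟨ ⊛-cong M (λ c → sym (⟦⟧-comb a (λv c) b (λw c))) r ⟩
    (M ⊛ (λ c → ⟦ a ℤ.* λv c ℤ.+ b ℤ.* λw c ⟧)) r
      ∎
    where open ≡-Reasoning

columns⊆InLattice : ∀ {d k} (M : Mat d k) → (_∈ columns M) ⊆ InLattice M
columns⊆InLattice M g∈ with ∈-tabulate⁻ g∈
... | c , refl = δ c , λ r → sym (trans (⊛-cong M (⟦δ⟧≡unit c) r) (⊛-unit M c r))

InLattice⊆Span : ∀ {d k} (M : Mat d k) → InLattice M ⊆ Span (columns M)
InLattice⊆Span {k = ℕ.zero} M (λv , v≗) = resp v≗ 𝟘∈
InLattice⊆Span {k = suc k}  M (λv , v≗) =
  resp (λ r → trans (v≗ r) (first-column-split r))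
       (comb (λv zero) (+ 1) (gen (here refl))
             (Span-mono (gen ∘ there) (InLattice⊆Span M′ ((λv ∘ suc) , λ r → refl))))
  where
  M′ : Mat _ k
  M′ r c = M r (suc c)
  first-column-split : ∀ r → (M ⊛ (⟦_⟧ ∘ λv)) r
                           ≡ ⟦ λv zero ⟧ ℚ.* M r zero ℚ.+ 1ℚ ℚ.* (M′ ⊛ (⟦_⟧ ∘ λv ∘ suc)) r
  first-column-split r = solve 3 (λ m x s → m :* x :+ s := x :* m :+ con 1ℚ :* s) refl
                               (M r zero) ⟦ λv zero ⟧ ((M′ ⊛ (⟦_⟧ ∘ λv ∘ suc)) r)

InLattice⇔Span : ∀ {d k} (M : Mat d k) v → InLattice M v ⇔ Span (columns M) v
InLattice⇔Span M v = mk⇔ (InLattice⊆Span M) (Span-minimal (inLattice-isSubmodule M) (columns⊆InLattice M))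

-- Invariants of the algorithm

bezout⇒unimodular : ∀ {g t h} α β u v → g ≢ + 0 →
                    h ≡ α ℤ.* g ℤ.+ β ℤ.* t → g ≡ u ℤ.* h → t ≡ v ℤ.* h →
                    α ℤ.* u ℤ.+ β ℤ.* v ≡ + 1
bezout⇒unimodular {g} {t} {h} α β u v g≢0 h≡ g≡ t≡ =
  ℤP.*-cancelʳ-≡ _ _ h {{ℤ.≢-nonZero h≢0}} (begin
    (α ℤ.* u ℤ.+ β ℤ.* v) ℤ.* h          ≡⟨ ℤSolver.solve (α List.∷ β List.∷ u List.∷ v List.∷ h List.∷ List.[]) ⟩
    α ℤ.* (u ℤ.* h) ℤ.+ β ℤ.* (v ℤ.* h)  ≡⟨ cong₂ (λ p q → α ℤ.* p ℤ.+ β ℤ.* q) g≡ t≡ ⟨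
    α ℤ.* g ℤ.+ β ℤ.* t                  ≡⟨ h≡ ⟨
    h                                    ≡⟨ ℤP.*-identityˡ h ⟨
    + 1 ℤ.* h                            ∎)
  where
  open ≡-Reasoning
  h≢0 : h ≢ + 0
  h≢0 h≡0 = g≢0 (trans g≡ (trans (cong (u ℤ.*_) h≡0) (ℤP.*-zeroʳ u)))

∼-unimodular : ∀ {d} α β u v (Z x : Col d) gs → α ℤ.* u ℤ.+ β ℤ.* v ≡ + 1 →
               Z ∷ x ∷ gs ∼ (α · Z ⊕ β · x) ∷ (u · x ⊖ v · Z) ∷ gs
∼-unimodular α β u v Z x gs det≡1 = old⊑new , new⊑old
  where
  Z′ = α · Z ⊕ β · x
  x′ = u · x ⊖ v · Z
  det : ⟦ α ⟧ ℚ.* ⟦ u ⟧ ℚ.+ ⟦ β ⟧ ℚ.* ⟦ v ⟧ ≡ 1ℚ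
  det = trans (sym (⟦⟧-comb α u β v)) (cong ⟦_⟧ det≡1)
  Z≗ : Z ≗ u · Z′ ⊕ (ℤ.- β) · x′
  Z≗ r = begin
    Z r                                                     ≡⟨ ℚP.*-identityˡ (Z r) ⟨
    1ℚ ℚ.* Z r                                              ≡⟨ cong (ℚ._* Z r) det ⟨
    (⟦ α ⟧ ℚ.* ⟦ u ⟧ ℚ.+ ⟦ β ⟧ ℚ.* ⟦ v ⟧) ℚ.* Z r
      ≡⟨ solve 6 (λ a b c e z y → (a :* c :+ b :* e) :* z := c :* (a :* z :+ b :* y) :+ (:- b) :* (c :* y :- e :* z))
               refl ⟦ α ⟧ ⟦ β ⟧ ⟦ u ⟧ ⟦ v ⟧ (Z r) (x r) ⟩
    ⟦ u ⟧ ℚ.* Z′ r ℚ.+ (ℚ.- ⟦ β ⟧) ℚ.* x′ r                 ≡⟨ cong (λ q → ⟦ u ⟧ ℚ.* Z′ r ℚ.+ q ℚ.* x′ r) (⟦⟧-neg β) ⟨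
    ⟦ u ⟧ ℚ.* Z′ r ℚ.+ ⟦ ℤ.- β ⟧ ℚ.* x′ r                   ∎
    where open ≡-Reasoning
  x≗ : x ≗ v · Z′ ⊕ α · x′
  x≗ r = begin
    x r                                                     ≡⟨ ℚP.*-identityˡ (x r) ⟨
    1ℚ ℚ.* x r                                              ≡⟨ cong (ℚ._* x r) det ⟨
    (⟦ α ⟧ ℚ.* ⟦ u ⟧ ℚ.+ ⟦ β ⟧ ℚ.* ⟦ v ⟧) ℚ.* x r
      ≡⟨ solve 6 (λ a b c e z y → (a :* c :+ b :* e) :* y := e :* (a :* z :+ b :* y) :+ a :* (c :* y :- e :* z))
               refl ⟦ α ⟧ ⟦ β ⟧ ⟦ u ⟧ ⟦ v ⟧ (Z r) (x r) ⟩
    ⟦ v ⟧ ℚ.* Z′ r ℚ.+ ⟦ α ⟧ ℚ.* x′ r                       ∎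
    where open ≡-Reasoning
  x′≗ : x′ ≗ u · x ⊕ (ℤ.- v) · Z
  x′≗ r = begin
    ⟦ u ⟧ ℚ.* x r ℚ.- ⟦ v ⟧ ℚ.* Z r          ≡⟨ solve 4 (λ c e z y → c :* y :- e :* z := c :* y :+ (:- e) :* z) refl ⟦ u ⟧ ⟦ v ⟧ (Z r) (x r) ⟩
    ⟦ u ⟧ ℚ.* x r ℚ.+ (ℚ.- ⟦ v ⟧) ℚ.* Z r    ≡⟨ cong (λ q → ⟦ u ⟧ ℚ.* x r ℚ.+ q ℚ.* Z r) (⟦⟧-neg v) ⟨
    ⟦ u ⟧ ℚ.* x r ℚ.+ ⟦ ℤ.- v ⟧ ℚ.* Z r      ∎
    where open ≡-Reasoning
  old⊑new : Z ∷ x ∷ gs ⊑ Z′ ∷ x′ ∷ gs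
  old⊑new (here refl)         = resp Z≗ (comb u (ℤ.- β) (gen (here refl)) (gen (there (here refl))))
  old⊑new (there (here refl)) = resp x≗ (comb v α (gen (here refl)) (gen (there (here refl))))
  old⊑new (there (there g∈))  = gen (there (there g∈))
  new⊑old : Z′ ∷ x′ ∷ gs ⊑ Z ∷ x ∷ gs
  new⊑old (here refl)         = comb α β (gen (here refl)) (gen (there (here refl)))
  new⊑old (there (here refl)) = resp x′≗ (comb u (ℤ.- v) (gen (there (here refl))) (gen (here refl)))
  new⊑old (there (there g∈))  = gen (there (there g∈))

InnerRun-span : ∀ {d} {ℓ : Fin d} {t g Z k} {xs xs′ : Vec (Col d) k} {Zf} →
                InnerRun ℓ t g Z xs xs′ Zf → g ≢ + 0 → Z ∷ toList xs ∼ Zf ∷ toList xs′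
InnerRun-span done _ = ∼-refl
InnerRun-span {g = g} {Z} (step {x = x} {xs} {xs′} {Zf} tj α β u v _ bezout g≡ tj≡ run) g≢0 = begin
  Z ∷ x ∷ toList xs      ≈⟨ ∼-unimodular α β u v Z x (toList xs) (bezout⇒unimodular α β u v g≢0 bezout g≡ tj≡) ⟩
  Z′ ∷ x′ ∷ toList xs    ≈⟨ ↭⇒∼ (swap Z′ x′ ↭-refl) ⟩
  x′ ∷ Z′ ∷ toList xs    ≈⟨ ∼-∷ x′ (InnerRun-span run g′≢0) ⟩
  x′ ∷ Zf ∷ toList xs′   ≈⟨ ↭⇒∼ (swap x′ Zf ↭-refl) ⟩
  Zf ∷ x′ ∷ toList xs′   ∎
  where
  open ∼-Reasoning
  Z′ = α · Z ⊕ β · x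
  x′ = u · x ⊖ v · Z
  g′≢0 : gcd g tj ≢ + 0
  g′≢0 g′≡0 = g≢0 (trans g≡ (trans (cong (u ℤ.*_) g′≡0) (ℤP.*-zeroʳ u)))

InnerRun-clears-pivot : ∀ {d} {ℓ : Fin d} {t g Z k} {xs xs′ : Vec (Col d) k} {Zf} →
                        InnerRun ℓ t g Z xs xs′ Zf → t ≢ + 0 → ⟦ t ⟧ ℚ.* Z ℓ ≡ ⟦ g ⟧ →
                        (_∈ toList xs′) ⊆ (λ x → x ℓ ≡ 0ℚ)
InnerRun-clears-pivot {ℓ = ℓ} {t} {g} {Z} (step {x = x} tj α β u v tx≡tj bezout g≡ tj≡ run) t≢0 tZ≡g
  = λ { (here refl) → ⟦⟧-*-cancelˡ t t≢0 t·x′≡0 ; (there x∈) → InnerRun-clears-pivot run t≢0 t·Z′≡g′ x∈ }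
  where
  open ≡-Reasoning
  g′ = gcd g tj
  t·x′≡0 : ⟦ t ⟧ ℚ.* (⟦ u ⟧ ℚ.* x ℓ ℚ.- ⟦ v ⟧ ℚ.* Z ℓ) ≡ 0ℚ
  t·x′≡0 = begin
    ⟦ t ⟧ ℚ.* (⟦ u ⟧ ℚ.* x ℓ ℚ.- ⟦ v ⟧ ℚ.* Z ℓ)
      ≡⟨ solve 5 (λ s a b y z → s :* (a :* y :- b :* z) := a :* (s :* y) :- b :* (s :* z)) refl ⟦ t ⟧ ⟦ u ⟧ ⟦ v ⟧ (x ℓ) (Z ℓ) ⟩
    ⟦ u ⟧ ℚ.* (⟦ t ⟧ ℚ.* x ℓ) ℚ.- ⟦ v ⟧ ℚ.* (⟦ t ⟧ ℚ.* Z ℓ)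
      ≡⟨ cong₂ (λ p q → ⟦ u ⟧ ℚ.* p ℚ.- ⟦ v ⟧ ℚ.* q) tx≡tj tZ≡g ⟩
    ⟦ u ⟧ ℚ.* ⟦ tj ⟧ ℚ.- ⟦ v ⟧ ℚ.* ⟦ g ⟧
      ≡⟨ cong₂ (λ p q → ⟦ u ⟧ ℚ.* p ℚ.- ⟦ v ⟧ ℚ.* q) (trans (cong ⟦_⟧ tj≡) (⟦⟧-* v g′)) (trans (cong ⟦_⟧ g≡) (⟦⟧-* u g′)) ⟩
    ⟦ u ⟧ ℚ.* (⟦ v ⟧ ℚ.* ⟦ g′ ⟧) ℚ.- ⟦ v ⟧ ℚ.* (⟦ u ⟧ ℚ.* ⟦ g′ ⟧)
      ≡⟨ solve 3 (λ a b h → a :* (b :* h) :- b :* (a :* h) := con 0ℚ) refl ⟦ u ⟧ ⟦ v ⟧ ⟦ g′ ⟧ ⟩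
    0ℚ
      ∎
  t·Z′≡g′ : ⟦ t ⟧ ℚ.* (⟦ α ⟧ ℚ.* Z ℓ ℚ.+ ⟦ β ⟧ ℚ.* x ℓ) ≡ ⟦ g′ ⟧
  t·Z′≡g′ = begin
    ⟦ t ⟧ ℚ.* (⟦ α ⟧ ℚ.* Z ℓ ℚ.+ ⟦ β ⟧ ℚ.* x ℓ)
      ≡⟨ solve 5 (λ s a b z y → s :* (a :* z :+ b :* y) := a :* (s :* z) :+ b :* (s :* y)) refl ⟦ t ⟧ ⟦ α ⟧ ⟦ β ⟧ (Z ℓ) (x ℓ) ⟩
    ⟦ α ⟧ ℚ.* (⟦ t ⟧ ℚ.* Z ℓ) ℚ.+ ⟦ β ⟧ ℚ.* (⟦ t ⟧ ℚ.* x ℓ)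
      ≡⟨ cong₂ (λ p q → ⟦ α ⟧ ℚ.* p ℚ.+ ⟦ β ⟧ ℚ.* q) tZ≡g tx≡tj ⟩
    ⟦ α ⟧ ℚ.* ⟦ g ⟧ ℚ.+ ⟦ β ⟧ ℚ.* ⟦ tj ⟧
      ≡⟨ ⟦⟧-comb α g β tj ⟨
    ⟦ α ℤ.* g ℤ.+ β ℤ.* tj ⟧
      ≡⟨ cong ⟦_⟧ bezout ⟨
    ⟦ g′ ⟧
      ∎

units : ∀ {d} → List (Fin d) → List (Col d)
units = map unit

finalColumns : ∀ {d m k} {X : Vec (Col d) m} {ℓs : Vec (Fin d) k} {Ys : Vec (Col d) k} →
               OuterRun X ℓs Ys → Vec (Col d) m
finalColumns {X = X} done            = X
finalColumns (step _ _ _ _ rest)     = finalColumns rest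

OuterRun-span : ∀ {d m k} {X : Vec (Col d) m} {ℓs : Vec (Fin d) k} {Ys : Vec (Col d) k} →
                (run : OuterRun X ℓs Ys) →
                units (toList ℓs) ++ toList X ∼ toList Ys ++ toList (finalColumns run)
OuterRun-span done = ∼-refl
OuterRun-span {X = X} (step {X' = X′} {ℓs = ℓs} {Ys = Ys} {Y = Y} ℓ t t>0 inner rest) = begin
  unit ℓ ∷ units (toList ℓs) ++ toList X     ≈⟨ ↭⇒∼ (prep (unit ℓ) (++-comm (units (toList ℓs)) (toList X))) ⟩
  (unit ℓ ∷ toList X) ++ units (toList ℓs)   ≈⟨ ∼-++ (InnerRun-span inner t≢0) ∼-refl ⟩
  (Y ∷ toList X′) ++ units (toList ℓs)       ≈⟨ ↭⇒∼ (prep Y (++-comm (toList X′) (units (toList ℓs)))) ⟩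
  Y ∷ units (toList ℓs) ++ toList X′         ≈⟨ ∼-∷ Y (OuterRun-span rest) ⟩
  Y ∷ toList Ys ++ toList (finalColumns rest) ∎
  where
  open ∼-Reasoning
  t≢0 : + t ≢ + 0
  t≢0 = ℕP.n>0⇒n≢0 t>0 ∘ ℤP.+-injective

Pivot : ∀ {d k} → Vec (Fin d) k → Pred (Fin d) 0ℓ
Pivot ℓs r = ∃ λ i → lookup ℓs i ≡ r

OuterRun-vanishes : ∀ {d m k} {X : Vec (Col d) m} {ℓs : Vec (Fin d) k} {Ys : Vec (Col d) k} →
                    (run : OuterRun X ℓs Ys) (Q : Pred (Fin d) 0ℓ) → Distinct ℓs → (∀ i → ¬ Q (lookup ℓs i)) →
                    (_∈ toList X) ⊆ Vanishes Q → (_∈ toList (finalColumns run)) ⊆ Vanishes (Q ∪ Pivot ℓs)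
OuterRun-vanishes done Q _ _ X-van x∈ r = [ X-van x∈ r , (λ { (() , _) }) ]
OuterRun-vanishes {X = X} (step {X' = X′} {ℓs = ℓs} ℓ t t>0 inner rest) Q distinct fresh X-van =
  Vanishes-anti regroup ∘ OuterRun-vanishes rest (Q ∪ ｛ ℓ ｝) distinct′ fresh′ X′-van
  where
  t≢0 : + t ≢ + 0
  t≢0 = ℕP.n>0⇒n≢0 t>0 ∘ ℤP.+-injective
  start-van : (_∈ unit ℓ ∷ toList X) ⊆ Vanishes Q
  start-van (here refl) r q = unit-offdiag (λ r≡ℓ → fresh zero (subst Q r≡ℓ q))
  start-van (there x∈)      = X-van x∈
  X′-van : (_∈ toList X′) ⊆ Vanishes (Q ∪ ｛ ℓ ｝)
  X′-van x∈ r (inj₁ q)    =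
    Span-minimal (vanishes-isSubmodule Q) start-van (proj₂ (InnerRun-span inner t≢0) (there x∈)) r q
  X′-van x∈ r (inj₂ refl) =
    InnerRun-clears-pivot inner t≢0 (trans (cong (⟦ + t ⟧ ℚ.*_) (unit-diag ℓ)) (ℚP.*-identityʳ ⟦ + t ⟧)) x∈
  distinct′ : Distinct ℓs
  distinct′ i j eq = FinP.suc-injective (distinct (suc i) (suc j) eq)
  fresh′ : ∀ i → ¬ (Q ∪ ｛ ℓ ｝) (lookup ℓs i)
  fresh′ i (inj₁ q)   = fresh (suc i) q
  fresh′ i (inj₂ ℓ≡) = contradiction (distinct zero (suc i) ℓ≡) λ ()
  regroup : Q ∪ Pivot (ℓ ∷ ℓs) ⊆ (Q ∪ ｛ ℓ ｝) ∪ Pivot ℓs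
  regroup (inj₁ q)             = inj₁ (inj₁ q)
  regroup (inj₂ (zero , ℓ≡))   = inj₁ (inj₂ ℓ≡)
  regroup (inj₂ (suc i , ℓ≡))  = inj₂ (i , ℓ≡)

-- Pigeonhole: a value r missed by ℓs would make j ↦ ℓs[j] an injection of Fin (1 + n) into Fin (1 + n) ∖ {r}.
Distinct⇒surjective : ∀ {n} (ℓs : Vec (Fin n) n) → Distinct ℓs → ∀ r → Pivot ℓs r
Distinct⇒surjective ℓs distinct r with FinP.any? (λ i → lookup ℓs i ≟ r)
... | yes hit = hit
Distinct⇒surjective {suc n} ℓs distinct r | no miss =
  contradiction (FinP.injective⇒≤ {f = avoid-r} avoid-r-injective) ℕP.1+n≰n
  where
  r≢ : ∀ j → r ≢ lookup ℓs j
  r≢ j r≡ = miss (j , sym r≡)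
  avoid-r : Fin (suc n) → Fin n
  avoid-r j = Fin.punchOut (r≢ j)
  avoid-r-injective : ∀ {i j} → avoid-r i ≡ avoid-r j → i ≡ j
  avoid-r-injective {i} {j} eq = distinct i j (FinP.punchOut-injective (r≢ i) (r≢ j) eq)

OuterRun-complete : ∀ {d m} {X : Vec (Col d) m} {ℓs : Vec (Fin d) d} {Ys : Vec (Col d) d} →
                    OuterRun X ℓs Ys → Distinct ℓs → units (toList ℓs) ++ toList X ∼ toList Ys
OuterRun-complete {ℓs = ℓs} {Ys} run distinct = ∼-trans (OuterRun-span run) (++-null (toList Ys) final≗𝟘)
  where
  final≗𝟘 : (_∈ toList (finalColumns run)) ⊆ (_≗ 𝟘)
  final≗𝟘 x∈ r = OuterRun-vanishes run (λ _ → ⊥) distinct (λ _ ()) (λ _ _ ()) x∈ r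
                   (inj₂ (Distinct⇒surjective ℓs distinct r))

-- The columns of A and of S

columns-integral : ∀ {d n} (A : Fin d → Fin n → ℤ) → (_∈ columns (toℚMat A)) ⊆ IsIntegral
columns-integral A g∈ with ∈-tabulate⁻ g∈
... | k , refl = λ r → A r k , refl

selectColumns : ∀ {d n k} → Mat d n → (Fin k → Fin n) → Mat d k
selectColumns A f r i = A r (f i)

columns-∼-image : ∀ {d m n} (A : Mat d n) (col : Fin d ⊎ Fin m → Fin n) → (∀ k → ∃ λ a → col a ≡ k) →
                  (X : Vec (Col d) m) →
                  (∀ j → selectColumns A (col ∘ inj₁) ⊛ lookup X j ≗ column A (col (inj₂ j))) →
                  (is : List (Fin d)) → (∀ i → i ∈ is) →
                  columns A ∼ map (selectColumns A (col ∘ inj₁) ⊛_) (units is ++ toList X)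
columns-∼-image A col col-onto X BX≡C is all∈is = A⊑ , ⊒A
  where
  B = selectColumns A (col ∘ inj₁)
  A⊑ : columns A ⊑ map (B ⊛_) (units is ++ toList X)
  A⊑ g∈ with ∈-tabulate⁻ g∈
  ... | k , refl with col-onto k
  ...   | inj₁ i , refl =
    resp (sym ∘ ⊛-unit B i) (gen (∈-map⁺ (B ⊛_) (∈-++⁺ˡ (∈-map⁺ unit (all∈is i)))))
  ...   | inj₂ j , refl =
    resp (sym ∘ BX≡C j) (gen (∈-map⁺ (B ⊛_) (∈-++⁺ʳ (units is) (VecMem.∈-toList⁺ (VecMem.∈-lookup j X)))))
  ⊒A : map (B ⊛_) (units is ++ toList X) ⊑ columns A
  ⊒A g∈ with ∈-map⁻ (B ⊛_) g∈
  ... | w , w∈ , refl with ∈-++⁻ (units is) w∈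
  ...   | inj₁ e∈ with ∈-map⁻ unit e∈
  ...     | i , _ , refl = resp (⊛-unit B i) (gen (∈-tabulate⁺ (col (inj₁ i))))
  ⊒A g∈ | w , w∈ , refl | inj₂ x∈ with VecMem.∈-toList⁻ x∈
  ...   | x∈X with VecAny.index x∈X | VecAnyP.lookup-index x∈X
  ...     | j | refl = resp (BX≡C j) (gen (∈-tabulate⁺ (col (inj₂ j))))

map-⊛-toList : ∀ {d k m} (M : Mat d k) (Y : Vec (Col k) m) →
               map (M ⊛_) (toList Y) ≡ columns (λ r i → (M ⊛ lookup Y i) r)
map-⊛-toList M []      = refl
map-⊛-toList M (y ∷ Y) = cong ((M ⊛ y) ∷_) (map-⊛-toList M Y)

theorem4 : (d n : ℕ) (A : Fin d → Fin n → ℤ)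
    → RowsIndependent (toℚMat A)
    → d < n
    → (col : Fin d ⊎ Fin (n ∸ d) → Fin n)
    → (∀ a b → col a ≡ col b → a ≡ b)
    → (∀ k → Σ (Fin d ⊎ Fin (n ∸ d)) (λ a → col a ≡ k))
    → ColsIndependent (λ r i → toℚMat A r (col (inj₁ i)))
    → (X : Vec (Col d) (n ∸ d))
    → (∀ j r → ((λ r' i → toℚMat A r' (col (inj₁ i))) ⊛ lookup X j) r ≡ toℚMat A r (col (inj₂ j)))
    → (ℓs : Vec (Fin d) d) → Distinct ℓs
    → (Y : Vec (Col d) d)
    → OuterRun X ℓs Y
    → let S : Mat d d
          S r i = ((λ r' c → toℚMat A r' (col (inj₁ c))) ⊛ lookup Y i) r
      in (∀ r i → Σ ℤ (λ z → S r i ≡ ⟦ z ⟧))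
         × (∀ v → InLattice (toℚMat A) v ⇔ InLattice S v)
theorem4 d n A _ _ col _ col-onto _ X BX≡C ℓs distinct Y run = S-integral , same-lattice
  where
  B : Mat d d
  B = selectColumns (toℚMat A) (col ∘ inj₁)
  S : Mat d d
  S r i = (B ⊛ lookup Y i) r
  pivot∈ℓs : ∀ r → r ∈ toList ℓs
  pivot∈ℓs r with Distinct⇒surjective ℓs distinct r
  ... | i , refl = VecMem.∈-toList⁺ (VecMem.∈-lookup i ℓs)
  A∼S : columns (toℚMat A) ∼ columns S
  A∼S = begin
    columns (toℚMat A)                             ≈⟨ columns-∼-image (toℚMat A) col col-onto X BX≡C (toList ℓs) pivot∈ℓs ⟩
    map (B ⊛_) (units (toList ℓs) ++ toList X)    ≈⟨ ∼-map B (OuterRun-complete run distinct) ⟩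
    map (B ⊛_) (toList Y)                          ≈⟨ ∼-reflexive (map-⊛-toList B Y) ⟩
    columns S                                      ∎
    where open ∼-Reasoning
  S-integral : ∀ r i → Σ ℤ (λ z → S r i ≡ ⟦ z ⟧)
  S-integral r i = Span-minimal integral-isSubmodule (columns-integral A) (proj₂ A∼S (∈-tabulate⁺ i)) r
  same-lattice : ∀ v → InLattice (toℚMat A) v ⇔ InLattice S v
  same-lattice v = ⇔-trans (InLattice⇔Span (toℚMat A) v) (⇔-trans (∼⇒Span⇔ A∼S v) (⇔-sym (InLattice⇔Span S v)))
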